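{- Let $m\geq 3$ be an integer, and let $\Delta:[1,4m-5]\to[1,4]$ be a $4$-coloring. If $|\Delta^{ -1}(c)|\geq 3m-3$ for some $c\in[1,4]$, then $\Delta$ is not an $L(4)$-coloring (with respect to $m$).
   Context: For integers $a,b$, $[a,b]$ denotes the set of integers $i$ with $a\le i\le b$. An $m$-set $Z=(z_1,\ldots,z_m)$ is a set of $m$ positive integers listed increasingly, $z_1<\cdots<z_m$. For $m$-sets $X,Y$, write $X\prec Y$ if $x_m<y_1$. A set $T$ is monochromatic under a coloring $\Delta$ if $\Delta$ is constant on $T$. Given $m$ and $r$, an $r$-coloring $\Delta:S\to[1,r]$ of a nonempty set $S$ of integers is an $L(r)$-coloring if there do not exist monochromatic $m$-sets $X,Y\subset S$ with $X\prec Y$ and $2(x_m-x_1)\leq y_m-x_1$. -}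

module Defs where

open import Data.Nat using (ℕ; zero; suc; _≤_; _<_; _+_; _*_; _∸_)
open import Data.Fin using (Fin; fromℕ) renaming (zero to fzero; _<_ to _<ᶠ_)
import Data.Fin as Fin
open import Data.List using (List; map; filter; length; upTo)
open import Data.Product using (Σ; ∃; _×_; _,_)
open import Data.Empty using (⊥)
open import Relation.Nullary using (¬_)
open import Relation.Binary.PropositionalEquality using (_≡_)

_∈[_,_] : ℕ → ℕ → ℕ → Set
i ∈[ a , b ] = a ≤ i × i ≤ b

-- An m-set with m = suc n : strictly increasing map Fin (suc n) → ℕ of positive integers
record MSet (n : ℕ) : Set where
  constructor mset
  field
    elt     : Fin (suc n) → ℕ
    pos     : ∀ i → 1 ≤ elt i
    strict  : ∀ i j → i <ᶠ j → elt i < elt j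
open MSet public

firstE : ∀ {n} → MSet n → ℕ
firstE Z = elt Z fzero

lastE : ∀ {n} → MSet n → ℕ
lastE {n} Z = elt Z (fromℕ n)

_⊆ₛ_ : ∀ {n} → MSet n → (ℕ → Set) → Set
Z ⊆ₛ S = ∀ i → S (elt Z i)

Mono : ∀ {n r} → (ℕ → Fin r) → MSet n → Set
Mono Δ Z = ∀ i j → Δ (elt Z i) ≡ Δ (elt Z j)

_≺_ : ∀ {n} → MSet n → MSet n → Set
X ≺ Y = lastE X < firstE Y

BadPair : (n r : ℕ) → (S : ℕ → Set) → (ℕ → Fin r) → Set
BadPair n r S Δ =
  Σ (MSet n) λ X → Σ (MSet n) λ Y →
    X ⊆ₛ S × Y ⊆ₛ S × Mono Δ X × Mono Δ Y × X ≺ Y ×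
    2 * (lastE X ∸ firstE X) ≤ lastE Y ∸ firstE X

-- Δ : S → [1,r] (colors as Fin r; only values on S matter) is an L(r)-coloring w.r.t. m.
-- m = 0 is meaningless (x_m undefined); only m ≥ 1 is used.
IsLColoring : (m r : ℕ) → (S : ℕ → Set) → (ℕ → Fin r) → Set
IsLColoring zero    r S Δ = ⊥
IsLColoring (suc n) r S Δ = ¬ BadPair n r S Δ

countColor : ∀ {r} → (N : ℕ) → (ℕ → Fin r) → Fin r → ℕ
countColor N Δ c = length (filter (λ i → Δ i Fin.≟ c) (map suc (upTo N)))

-- Within [1, 4m-5] the colour class c has at least 3m-3 elements a₀ < a₁ < ⋯.
-- Take X = (a₀, …, a_{m-1}) and Y = (a_d, …, a_{d+m-1}) with d = 2m-3 ≥ m.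
-- Writing u = a_{m-1} - a₀ and v = y_m - a_{m-1}, the d index steps give v ≥ d,
-- while a₀ ≥ 1 and y_m ≤ 4m-5 give u + v ≤ 2d; hence u ≤ v, i.e.
-- 2(x_m - x₁) = 2u ≤ u + v = y_m - x₁.
module Submission where

open import Defs
open import Data.Nat using (ℕ; zero; suc; _+_; _*_; _∸_; _≤_; _<_; z≤n; s≤s)
open import Data.Nat.Properties
open import Data.Nat.Tactic.RingSolver using (solve-∀)
open import Data.Fin using (Fin; toℕ; fromℕ) renaming (zero to fzero)
import Data.Fin as Fin
open import Data.Fin.Properties using (toℕ≤pred[n]; toℕ-fromℕ)
open import Data.List using (List; []; _∷_; length; filter; map; upTo)
open import Data.List.Relation.Unary.All as All using (All; _∷_)
import Data.List.Relation.Unary.All.Properties as All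
open import Data.List.Relation.Unary.AllPairs using (AllPairs; _∷_)
import Data.List.Relation.Unary.AllPairs.Properties as AllPairs
open import Data.Product using (∃; _,_; proj₁; proj₂)
open import Relation.Nullary using (¬_)
open import Relation.Binary.PropositionalEquality

firstE≤lastE : ∀ {n} (Z : MSet n) → firstE Z ≤ lastE Z
firstE≤lastE {zero}  Z = ≤-refl
firstE≤lastE {suc n} Z = <⇒≤ (strict Z fzero (fromℕ (suc n)) (s≤s z≤n))

-- The default 0 is never reached: every use below comes with an index bound.
nth : List ℕ → ℕ → ℕ
nth []       _       = 0
nth (x ∷ xs) zero    = x
nth (x ∷ xs) (suc i) = nth xs i

All-nth : ∀ {P : ℕ → Set} {xs j} → All P xs → j < length xs → P (nth xs j)
All-nth {j = zero}  (px ∷ _)  _         = px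
All-nth {j = suc j} (_  ∷ ps) (s≤s j<) = All-nth ps j<

nth-strictMono : ∀ {xs} → AllPairs _<_ xs → ∀ {i j} → i < j → j < length xs → nth xs i < nth xs j
nth-strictMono (x<xs ∷ _) {zero}  {suc j} _         (s≤s j<) = All-nth x<xs j<
nth-strictMono (_ ∷ sorted) {suc i} {suc j} (s≤s i<j) (s≤s j<) = nth-strictMono sorted i<j j<

nth-gap : ∀ {xs} → AllPairs _<_ xs → ∀ d {i} → d + i < length xs → d + nth xs i ≤ nth xs (d + i)
nth-gap sorted zero    _   = ≤-refl
nth-gap sorted (suc d) d+i< =
  ≤-trans (s≤s (nth-gap sorted d (<-trans (n<1+n _) d+i<)))
          (nth-strictMono sorted (n<1+n _) d+i<)

module Window (xs : List ℕ) (sorted : AllPairs _<_ xs) (positive : All (1 ≤_) xs)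
              (s n : ℕ) (s+n< : s + n < length xs) where

  index< : (i : Fin (suc n)) → s + toℕ i < length xs
  index< i = ≤-<-trans (+-monoʳ-≤ s (toℕ≤pred[n] i)) s+n<

  W : MSet n
  W = mset (λ i → nth xs (s + toℕ i)) (λ i → All-nth positive (index< i))
           (λ i j i<j → nth-strictMono sorted (+-monoʳ-< s i<j) (index< j))

  ⊆ : ∀ {P : ℕ → Set} → All P xs → ∀ i → P (elt W i)
  ⊆ all i = All-nth all (index< i)

  mono : ∀ {r} {Δ : ℕ → Fin r} {c} → All (λ x → Δ x ≡ c) xs → Mono Δ W
  mono coloured i j = trans (⊆ coloured i) (sym (⊆ coloured j))

  firstE≡ : firstE W ≡ nth xs s
  firstE≡ = cong (nth xs) (+-identityʳ s)

  lastE≡ : lastE W ≡ nth xs (s + n)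
  lastE≡ = cong (λ k → nth xs (s + k)) (toℕ-fromℕ n)

doubling : ∀ {a b c d} → a ≤ b → d + b ≤ c → c ≤ a + 2 * d → 2 * (b ∸ a) ≤ c ∸ a
doubling {a} {b} {c} {d} a≤b d+b≤c c≤a+2d = begin
  2 * u   ≡⟨ cong (u +_) (+-identityʳ u) ⟩
  u + u   ≤⟨ +-monoʳ-≤ u u≤v ⟩
  u + v   ≡⟨ c∸a≡u+v ⟨
  c ∸ a   ∎
  where
  open ≤-Reasoning
  u = b ∸ a
  v = c ∸ b
  c≡a+[u+v] : c ≡ a + (u + v)
  c≡a+[u+v] = begin-equality
    c            ≡⟨ m+[n∸m]≡n (≤-trans (m≤n+m b d) d+b≤c) ⟨
    b + v        ≡⟨ cong (_+ v) (m+[n∸m]≡n a≤b) ⟨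
    a + u + v    ≡⟨ +-assoc a u v ⟩
    a + (u + v)  ∎
  c∸a≡u+v : c ∸ a ≡ u + v
  c∸a≡u+v = trans (cong (_∸ a) c≡a+[u+v]) (m+n∸m≡n a (u + v))
  d≤v : d ≤ v
  d≤v = +-cancelˡ-≤ b d v (begin
    b + d  ≡⟨ +-comm b d ⟩
    d + b  ≤⟨ d+b≤c ⟩
    c      ≡⟨ m+[n∸m]≡n (≤-trans (m≤n+m b d) d+b≤c) ⟨
    b + v  ∎)
  u≤d : u ≤ d
  u≤d = +-cancelʳ-≤ d u d (begin
    u + d        ≤⟨ +-monoʳ-≤ u d≤v ⟩
    u + v        ≤⟨ +-cancelˡ-≤ a (u + v) (2 * d) (≤-trans (≤-reflexive (sym c≡a+[u+v])) c≤a+2d) ⟩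
    2 * d        ≡⟨ cong (d +_) (+-identityʳ d) ⟩
    d + d        ∎)
  u≤v : u ≤ v
  u≤v = ≤-trans u≤d d≤v

sortedMonochromatic⇒BadPair :
  ∀ {r N} n (Δ : ℕ → Fin r) c (xs : List ℕ) →
  AllPairs _<_ xs → All (λ x → x ∈[ 1 , N ]) xs → All (λ x → Δ x ≡ c) xs →
  ∀ d → suc n ≤ d → d + n < length xs → N ≤ 1 + 2 * d →
  BadPair n r (λ i → i ∈[ 1 , N ]) Δ
sortedMonochromatic⇒BadPair {N = N} n Δ c xs sorted inRange coloured d n<d d+n< N≤1+2d =
  X.W , Y.W , X.⊆ inRange , Y.⊆ inRange , X.mono coloured , Y.mono coloured ,
  X≺Y , 2[xm∸x1]≤ym∸x1
  where
  positive : All (1 ≤_) xs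
  positive = All.map proj₁ inRange
  module X = Window xs sorted positive 0 n (<-≤-trans n<d (≤-trans (m≤m+n d n) (<⇒≤ d+n<)))
  module Y = Window xs sorted positive d n d+n<
  X≺Y : X.W ≺ Y.W
  X≺Y = subst₂ _<_ (sym X.lastE≡) (sym Y.firstE≡)
          (nth-strictMono sorted n<d (≤-<-trans (m≤m+n d n) d+n<))
  ym≤x1+2d : lastE Y.W ≤ firstE X.W + 2 * d
  ym≤x1+2d = begin
    lastE Y.W           ≤⟨ proj₂ (Y.⊆ inRange (fromℕ n)) ⟩
    N                   ≤⟨ N≤1+2d ⟩
    1 + 2 * d           ≤⟨ +-monoˡ-≤ (2 * d) (X.⊆ positive fzero) ⟩
    firstE X.W + 2 * d  ∎
    where open ≤-Reasoning
  2[xm∸x1]≤ym∸x1 : 2 * (lastE X.W ∸ firstE X.W) ≤ lastE Y.W ∸ firstE X.W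
  2[xm∸x1]≤ym∸x1 = doubling (firstE≤lastE X.W)
    (subst₂ _≤_ (cong (d +_) (sym X.lastE≡)) (sym Y.lastE≡) (nth-gap sorted d d+n<))
    ym≤x1+2d

colourClass : ∀ {r} → ℕ → (ℕ → Fin r) → Fin r → List ℕ
colourClass N Δ c = filter (λ i → Δ i Fin.≟ c) (map suc (upTo N))

module _ {r} (N : ℕ) (Δ : ℕ → Fin r) (c : Fin r) where

  colourClass-sorted : AllPairs _<_ (colourClass N Δ c)
  colourClass-sorted = AllPairs.filter⁺ _ (AllPairs.map⁺
    (AllPairs.applyUpTo⁺₁ (λ i → i) N (λ i<j _ → s≤s i<j)))

  colourClass-inRange : All (λ x → x ∈[ 1 , N ]) (colourClass N Δ c)
  colourClass-inRange = All.filter⁺ _ (All.map⁺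
    (All.applyUpTo⁺₁ (λ i → i) N (λ i<N → s≤s z≤n , i<N)))

  colourClass-coloured : All (λ x → Δ x ≡ c) (colourClass N Δ c)
  colourClass-coloured = All.all-filter _ (map suc (upTo N))

lemma3p4 : (m : ℕ) → 3 ≤ m → (Δ : ℕ → Fin 4) →
    ∃ (λ c → 3 * m ∸ 3 ≤ countColor (4 * m ∸ 5) Δ c) →
    ¬ IsLColoring m 4 (λ i → i ∈[ 1 , 4 * m ∸ 5 ]) Δ
lemma3p4 m (s≤s (s≤s (s≤s (z≤n {p})))) Δ (c , large) noBadPair =
  noBadPair (sortedMonochromatic⇒BadPair (2 + p) Δ c (colourClass N Δ c)
    (colourClass-sorted N Δ c) (colourClass-inRange N Δ c) (colourClass-coloured N Δ c)
    d (+-monoʳ-≤ 3 (m≤m+n p (p + 0)))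
    (subst (_≤ length (colourClass N Δ c)) (cong (_∸ 3) (3m≡ p)) large)
    (≤-reflexive (cong (_∸ 5) (4m≡ p))))
  where
  N = 4 * m ∸ 5
  d = 3 + 2 * p
  3m≡ : ∀ q → 3 * (3 + q) ≡ 3 + suc ((3 + 2 * q) + (2 + q))
  3m≡ = solve-∀
  4m≡ : ∀ q → 4 * (3 + q) ≡ 5 + (1 + 2 * (3 + 2 * q))
  4m≡ = solve-∀
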